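{- Let $D=(V,E)$ be a digraph and $e\in E$ an arc of $D$. Then \[ \sigma(D)= \begin{cases} \sigma(D_{ -e})+x & \text{if } e \text{ is a loop},\\ \sigma(D_{ -e})+x\,\sigma(D_{/e})-x\,\sigma(D_{\dagger e}) & \text{if } e=(u,v) \text{ is not a loop and there are no loops on } u \text{ or } v. \end{cases} \]
   Context: Digraphs are finite directed multigraphs; loops and multiple arcs are allowed. A directed cycle of length $k\ge 1$ consists of $k$ distinct vertices $v_1,\dots,v_k$ together with arcs $(v_1,v_2),\dots,(v_{k-1},v_k),(v_k,v_1)$. A loop is a cycle of length 1 and two opposite arcs form a cycle of length 2. Cycles are counted as sets of arcs, so parallel arcs give different cycles. The cycle polynomial is $\sigma(D)=\sigma(D;x)=\sum_{k=1}^{|V|}c_k(D)x^k$, where $c_k(D)$ is the number of directed cycles of length $k$ in $D$. The arc operations are as follows. $D_{ -e}$ is obtained by deleting the arc $e$. If $e=(u,v)$ with $u\ne v$, then $D_{/e}$ is obtained from $D$ by removing all arcs with tail $u$ and all arcs with head $v$ (this includes $e$), and then identifying $u$ and $v$ into one new vertex. If $e=(u,u)$ is a loop, then $D_{/e}$ is obtained by deleting $u$ together with its incident arcs. For $e=(u,v)$, $D_{\dagger e}$ is obtained by deleting $u$ and $v$ and all arcs incident to them. -}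

module Defs where

open import Data.Nat as ℕ using (ℕ; zero; suc; _<?_)
open import Data.Integer as ℤ using (ℤ; +_)
open import Data.Fin as Fin using (Fin; zero; suc; toℕ; fromℕ<; punchOut)
open import Data.Fin.Properties using (all?) renaming (_≟_ to _≟ᶠ_)
open import Data.Fin.Subset using (Subset; ⁅_⁆; _∪_; ⊥)
open import Data.Bool using (Bool)
open import Data.Bool.Properties using () renaming (_≟_ to _≟ᵇ_)
open import Data.List as List using (List; []; _∷_; length; filter; map; concatMap; deduplicate; removeAt; mapMaybe; allFin)
open import Data.List.Membership.Propositional using (_∈_)
open import Data.Vec as Vec using (Vec; []; _∷_; lookup)
open import Data.Vec.Properties using (≡-dec)
open import Data.Maybe using (Maybe; just; nothing)
open import Data.Product using (_×_; _,_; proj₁; proj₂)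
open import Relation.Nullary using (¬_; Dec; yes; no)
open import Relation.Nullary.Decidable using (_×-dec_; _→-dec_; ¬?)
open import Relation.Binary.PropositionalEquality using (_≡_; _≢_; refl; sym)

-- Digraphs (finite directed multigraphs, loops and parallel arcs allowed)
-- Vertices: Fin n.  Parallel arcs are different list positions.

record Digraph : Set where
  constructor mkDigraph
  field
    n    : ℕ
    arcs : List (Fin n × Fin n)

open Digraph public

Vertex : Digraph → Set
Vertex D = Fin (n D)

Arc : Digraph → Set
Arc D = Fin (length (arcs D))

tailOf : (D : Digraph) → Arc D → Vertex D
tailOf D e = proj₁ (List.lookup (arcs D) e)

headOf : (D : Digraph) → Arc D → Vertex D
headOf D e = proj₂ (List.lookup (arcs D) e)

IsLoop : (D : Digraph) → Arc D → Set
IsLoop D e = tailOf D e ≡ headOf D e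

NoLoopAt : (D : Digraph) → Vertex D → Set
NoLoopAt D w = ¬ ((w , w) ∈ arcs D)

next : ∀ {k} → Fin (suc k) → Fin (suc k)
next {k} i with suc (toℕ i) <? suc k
... | yes p = fromℕ< p
... | no _  = zero

IsCycleSeq : (D : Digraph) {k : ℕ} → Vec (Arc D) (suc k) → Set
IsCycleSeq D {k} a =
  ((i : Fin (suc k)) → headOf D (lookup a i) ≡ tailOf D (lookup a (next i)))
  × ((i j : Fin (suc k)) → tailOf D (lookup a i) ≡ tailOf D (lookup a j) → i ≡ j)

isCycleSeq? : (D : Digraph) {k : ℕ} (a : Vec (Arc D) (suc k)) → Dec (IsCycleSeq D a)
isCycleSeq? D a =
  all? (λ i → headOf D (lookup a i) ≟ᶠ tailOf D (lookup a (next i)))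
  ×-dec all? (λ i → all? (λ j → (tailOf D (lookup a i) ≟ᶠ tailOf D (lookup a j)) →-dec (i ≟ᶠ j)))

allVecs : ∀ {m} (k : ℕ) → List (Vec (Fin m) k)
allVecs zero    = [] ∷ []
allVecs {m} (suc k) = concatMap (λ x → map (x ∷_) (allVecs k)) (allFin m)

arcSet : ∀ {m k} → Vec (Fin m) k → Subset m
arcSet []       = ⊥
arcSet (x ∷ xs) = ⁅ x ⁆ ∪ arcSet xs

-- c_k(D): the number of directed cycles of length k, counted as arc sets
cycleCount : Digraph → ℕ → ℕ
cycleCount D zero    = 0
cycleCount D (suc k) =
  length (deduplicate (≡-dec _≟ᵇ_)
           (map arcSet (filter (isCycleSeq? D) (allVecs {length (arcs D)} (suc k)))))

-- Polynomials with integer coefficients, as coefficient functions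
-- (p k = coefficient of x^k); equality is pointwise (_≗_).

Poly : Set
Poly = ℕ → ℤ

_+ₚ_ : Poly → Poly → Poly
(p +ₚ q) k = p k ℤ.+ q k

_-ₚ_ : Poly → Poly → Poly
(p -ₚ q) k = p k ℤ.- q k

X : Poly
X zero          = + 0
X (suc zero)    = + 1
X (suc (suc _)) = + 0

x*_ : Poly → Poly
(x* p) zero    = + 0
(x* p) (suc k) = p k

infixl 6 _+ₚ_ _-ₚ_
infix  7 x*_

σ : Digraph → Poly
σ D zero = + 0
σ D (suc k) with suc k ℕ.≤? n D
... | yes _ = + cycleCount D (suc k)
... | no _  = + 0

_−_ : (D : Digraph) → Arc D → Digraph
D − e = mkDigraph (n D) (removeAt (arcs D) e)

delVertex : ∀ {n} → Fin (suc n) → List (Fin (suc n) × Fin (suc n)) → List (Fin n × Fin n)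
delVertex {n} x = mapMaybe f
  where
  f : Fin (suc n) × Fin (suc n) → Maybe (Fin n × Fin n)
  f (t , h) with x ≟ᶠ t | x ≟ᶠ h
  ... | no p | no q = just (punchOut p , punchOut q)
  ... | _    | _    = nothing

contract : ∀ {n} → List (Fin n × Fin n) → Fin n → Fin n → Digraph
contract {suc n} as u v with u ≟ᶠ v
... | yes _ = mkDigraph n (delVertex u as)
... | no u≢v = mkDigraph n (map (λ (t , h) → (μ t , μ h)) kept)
  where
  -- identify u and v (v is mapped to the image of u)
  μ : Fin (suc n) → Fin n
  μ w with v ≟ᶠ w
  ... | yes _ = punchOut {i = v} {j = u} (λ eq → u≢v (sym eq))
  ... | no v≢w = punchOut v≢w
  kept : List (Fin (suc n) × Fin (suc n))
  kept = filter (λ (t , h) → ¬? (t ≟ᶠ u) ×-dec ¬? (h ≟ᶠ v)) as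

_/_ : (D : Digraph) → Arc D → Digraph
D / e = contract (arcs D) (tailOf D e) (headOf D e)

dagger : ∀ {n} → List (Fin n × Fin n) → Fin n → Fin n → Digraph
dagger {suc n} as u v with u ≟ᶠ v
... | yes _ = mkDigraph n (delVertex u as)
dagger {suc zero} as u v | no u≢v = mkDigraph zero []   -- impossible: Fin 1 has one element
dagger {suc (suc n)} as u v | no u≢v =
  mkDigraph n (delVertex (punchOut u≢v) (delVertex u as))

_†_ : (D : Digraph) → Arc D → Digraph
D † e = dagger (arcs D) (tailOf D e) (headOf D e)

module Submission where

-- Split the cycles of D according to whether they use e; those avoiding e are
-- exactly the cycles of D − e.  A loop e is a 1-cycle and lies on no other
-- cycle.  For a non-loop e = (u , v), a cycle through e leaves v and returns to
-- u without meeting u or v elsewhere, so deleting e and merging u with v into a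
-- vertex w turns it into a cycle of D / e through w, one arc shorter, and back.
-- The cycles of D / e avoiding w are those of D avoiding u and v, i.e. the
-- cycles of D † e.  Hence c_{k+1}(D / e) = c_{k+1}(D † e) + #{(k+2)-cycles
-- through e}, which is the recurrence.  Cycles of different digraphs are
-- compared as arc sets along injections of arc indices.  The truncation of σ at
-- |V| is harmless, since by pigeonhole no cycle is longer than |V|.

open import Defs
open import Data.Product using (_×_)
open import Relation.Nullary using (¬_)
open import Relation.Binary.PropositionalEquality using (_≗_)

open import Data.Bool.Properties using () renaming (_≟_ to _≟ᵇ_)
open import Data.Empty using (⊥)
open import Data.Fin as Fin using (Fin; zero; suc; toℕ; fromℕ; fromℕ<; inject₁; punchOut)
import Data.Fin.Properties as Fin
open import Data.Fin.Properties using (_≟_)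
open import Data.Fin.Subset as Sub using (Subset; ⁅_⁆; _∪_) renaming (⊥ to ∅; _∈_ to _∈ₛ_)
import Data.Fin.Subset.Properties as Sub
open import Data.Integer as ℤ using (ℤ; +_)
import Data.Integer.Properties as ℤ
open import Data.Integer.Tactic.RingSolver using (solve-∀)
open import Data.List as List using (List; []; _∷_; _++_; length; map; filter; deduplicate; removeAt; mapMaybe)
import Data.List.Properties as List
open import Data.List.Membership.Propositional using (_∈_; find)
import Data.List.Membership.Propositional.Properties as ∈
open import Data.List.Relation.Binary.Permutation.Propositional using (_↭_)
import Data.List.Relation.Binary.Permutation.Propositional as ↭
import Data.List.Relation.Binary.Permutation.Propositional.Properties as ↭
import Data.List.Relation.Binary.Permutation.Setoid.Properties as ↭ₛ
open import Data.List.Relation.Unary.All as All using (All; []; _∷_)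
import Data.List.Relation.Unary.All.Properties as All
open import Data.List.Relation.Unary.Any as Any using (here; there)
open import Data.List.Relation.Unary.Unique.Propositional using (Unique; []; _∷_)
import Data.List.Relation.Unary.Unique.Propositional.Properties as Unique
import Data.List.Relation.Unary.Unique.DecPropositional.Properties as Uniqueᵈ
open import Data.Maybe using (Maybe; just; nothing; _>>=_)
open import Data.Nat as ℕ using (ℕ; zero; suc; _+_; _≤_; z≤n; s≤s)
import Data.Nat.Properties as ℕ
import Data.Product as Product
open import Data.Product using (Σ; ∃-syntax; _,_; proj₁; proj₂)
open import Data.Sum using (_⊎_; inj₁; inj₂; [_,_]′)
open import Data.Unit using (⊤; tt)
open import Data.Vec as Vec using (Vec; []; _∷_; lookup; toList; _∷ʳ_)
import Data.Vec.Properties as Vec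
open import Data.Vec.Properties using (≡-dec)
open import Function using (_∘_)
open import Relation.Nullary using (Dec; yes; no; contradiction; ¬?)
open import Relation.Nullary.Decidable using (_×-dec_)
open import Relation.Unary using (Decidable)
open import Relation.Unary.Properties using (∁?)
import Relation.Binary.PropositionalEquality as ≡
open import Relation.Binary.PropositionalEquality using (_≡_; _≢_; refl; sym; trans; cong; cong₂; subst; module ≡-Reasoning)
open ≡-Reasoning

private variable
  A B : Set

record Correspondence (R : A → B → Set) (xs : List A) (ys : List B) : Set where
  field
    forth      : ∀ {x} → x ∈ xs → ∃[ y ] y ∈ ys × R x y
    back       : ∀ {y} → y ∈ ys → ∃[ x ] x ∈ xs × R x y
    injective  : ∀ {x x′ y} → R x y → R x′ y → x ≡ x′
    functional : ∀ {x y y′} → R x y → R x y′ → y ≡ y′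

∈-++-∷⁻ : ∀ {x y : A} ys {zs} → x ∈ ys ++ y ∷ zs → x ≢ y → x ∈ ys ++ zs
∈-++-∷⁻ []       (here refl)  x≢y = contradiction refl x≢y
∈-++-∷⁻ []       (there x∈zs) _   = x∈zs
∈-++-∷⁻ (_ ∷ ys) (here refl)  _   = here refl
∈-++-∷⁻ (_ ∷ ys) (there x∈)   x≢y = there (∈-++-∷⁻ ys x∈ x≢y)

length-++-∷ : ∀ (ys : List A) y zs → length (ys ++ y ∷ zs) ≡ suc (length (ys ++ zs))
length-++-∷ []       y zs = refl
length-++-∷ (_ ∷ ys) y zs = cong suc (length-++-∷ ys y zs)

length-≤-injection : (R : A → B → Set) {xs : List A} {ys : List B} → Unique xs →
  (∀ {x} → x ∈ xs → ∃[ y ] y ∈ ys × R x y) →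
  (∀ {x x′ y} → R x y → R x′ y → x ≡ x′) →
  length xs ≤ length ys
length-≤-injection R {[]}     _              _     _   = z≤n
length-≤-injection R {x ∷ xs} (x∉xs ∷ !xs) forth inj
  with y , y∈ys , Rxy ← forth (here refl)
  with ys₁ , ys₂ , refl ← ∈.∈-∃++ y∈ys =
  ℕ.≤-trans (s≤s (length-≤-injection R !xs forth′ inj)) (ℕ.≤-reflexive (sym (length-++-∷ ys₁ y ys₂)))
  where
  forth′ : ∀ {x′} → x′ ∈ xs → ∃[ y′ ] y′ ∈ ys₁ ++ ys₂ × R x′ y′
  forth′ x′∈xs with y′ , y′∈ , Rx′y′ ← forth (there x′∈xs) =
    y′ , ∈-++-∷⁻ ys₁ y′∈ (λ { refl → All.lookup x∉xs x′∈xs (inj Rxy Rx′y′) }) , Rx′y′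

length-≡-correspondence : {R : A → B → Set} {xs : List A} {ys : List B} →
  Unique xs → Unique ys → Correspondence R xs ys → length xs ≡ length ys
length-≡-correspondence {R = R} !xs !ys c = ℕ.≤-antisym
  (length-≤-injection R !xs forth injective)
  (length-≤-injection (λ y x → R x y) !ys back functional)
  where open Correspondence c

length-filter-∁ : ∀ {P : A → Set} (P? : Decidable P) xs →
  length xs ≡ length (filter P? xs) + length (filter (∁? P?) xs)
length-filter-∁ P? [] = refl
length-filter-∁ P? (x ∷ xs) with P? x
... | yes _ = cong suc (length-filter-∁ P? xs)
... | no _  = trans (cong suc (length-filter-∁ P? xs)) (sym (ℕ.+-suc _ _))

length-≡0 : {xs : List A} → (∀ {x} → x ∈ xs → ⊥) → length xs ≡ 0
length-≡0 {xs = []}    _   = refl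
length-≡0 {xs = x ∷ _} ∉xs = contradiction (here refl) ∉xs

length-≡1 : {xs : List A} {x : A} → Unique xs → x ∈ xs → (∀ {y} → y ∈ xs → y ≡ x) → length xs ≡ 1
length-≡1 {xs = y ∷ ys} (y∉ys ∷ _) _ ≡x = cong suc (length-≡0 (λ z∈ys →
  All.lookup y∉ys z∈ys (trans (≡x (here refl)) (sym (≡x (there z∈ys))))))

preimage : ∀ (f : A → B) {P : B → Set} {Q : A → Set} → (∀ {y} → P y → ∃[ x ] Q x × f x ≡ y) →
  ∀ ys → All P ys → ∃[ xs ] map f xs ≡ ys × All Q xs
preimage f onto []       []           = [] , refl , []
preimage f onto (y ∷ ys) (py ∷ P[ys])
  with x , qx , refl ← onto py | xs , refl , Q[xs] ← preimage f onto ys P[ys] =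
  x ∷ xs , refl , qx ∷ Q[xs]

Unique-map-transfer : ∀ {C : Set} (f : A → B) (g : A → C) xs → Unique (map f xs) →
  (∀ {x y} → x ∈ xs → y ∈ xs → g x ≡ g y → f x ≡ f y) → Unique (map g xs)
Unique-map-transfer f g []       _           _ = []
Unique-map-transfer f g (x ∷ xs) (fx∉ ∷ !fxs) g≡⇒f≡ =
  All.tabulate (λ gy∈ gx≡gy → let y , y∈ , gy≡ = ∈.∈-map⁻ g gy∈ in
    All.lookup fx∉ (∈.∈-map⁺ f y∈) (g≡⇒f≡ (here refl) (there y∈) (trans gx≡gy gy≡)))
  ∷ Unique-map-transfer f g xs !fxs (λ x∈ y∈ → g≡⇒f≡ (there x∈) (there y∈))

drop-∷ : ∀ m (xs : List A) {y ys} → List.drop m xs ≡ y ∷ ys → List.drop (suc m) xs ≡ ys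
drop-∷ zero    (x ∷ xs) refl = refl
drop-∷ (suc m) (x ∷ xs) eq   = drop-∷ m xs eq

mapMaybe-mapMaybe : ∀ {C : Set} (f : A → Maybe B) (g : B → Maybe C) xs →
  mapMaybe g (mapMaybe f xs) ≡ mapMaybe (λ x → f x >>= g) xs
mapMaybe-mapMaybe f g [] = refl
mapMaybe-mapMaybe f g (x ∷ xs) with f x
... | nothing = mapMaybe-mapMaybe f g xs
... | just y with g y
...   | nothing = mapMaybe-mapMaybe f g xs
...   | just z  = cong (z ∷_) (mapMaybe-mapMaybe f g xs)

module _ {A : Set} where

  skip : (xs : List A) (e : Fin (length xs)) → Fin (length (removeAt xs e)) → Fin (length xs)
  skip (x ∷ xs) zero    i       = suc i
  skip (x ∷ xs) (suc e) zero    = zero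
  skip (x ∷ xs) (suc e) (suc i) = suc (skip xs e i)

  lookup-removeAt : ∀ xs e i → List.lookup (removeAt xs e) i ≡ List.lookup xs (skip xs e i)
  lookup-removeAt (x ∷ xs) zero    i       = refl
  lookup-removeAt (x ∷ xs) (suc e) zero    = refl
  lookup-removeAt (x ∷ xs) (suc e) (suc i) = lookup-removeAt xs e i

  skip-≢ : ∀ xs e i → skip xs e i ≢ e
  skip-≢ (x ∷ xs) zero    i       ()
  skip-≢ (x ∷ xs) (suc e) zero    ()
  skip-≢ (x ∷ xs) (suc e) (suc i) eq = skip-≢ xs e i (Fin.suc-injective eq)

  skip-injective : ∀ xs e {i j} → skip xs e i ≡ skip xs e j → i ≡ j
  skip-injective (x ∷ xs) zero    eq = Fin.suc-injective eq
  skip-injective (x ∷ xs) (suc e) {zero}  {zero}  eq = refl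
  skip-injective (x ∷ xs) (suc e) {suc i} {suc j} eq = cong suc (skip-injective xs e (Fin.suc-injective eq))

  skip-onto : ∀ xs e j → j ≢ e → ∃[ i ] skip xs e i ≡ j
  skip-onto (x ∷ xs) zero    zero    j≢e = contradiction refl j≢e
  skip-onto (x ∷ xs) zero    (suc j) _   = j , refl
  skip-onto (x ∷ xs) (suc e) zero    _   = zero , refl
  skip-onto (x ∷ xs) (suc e) (suc j) j≢e = Product.map suc (cong suc) (skip-onto xs e j (j≢e ∘ cong suc))

module _ {A B : Set} (f : A → Maybe B) where

  source : (xs : List A) → Fin (length (mapMaybe f xs)) → Fin (length xs)
  source (x ∷ xs) i with f x
  ... | just _  with i
  ...   | zero  = zero
  ...   | suc i = suc (source xs i)
  source (x ∷ xs) i | nothing = suc (source xs i)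

  f-source : ∀ xs i → f (List.lookup xs (source xs i)) ≡ just (List.lookup (mapMaybe f xs) i)
  f-source (x ∷ xs) i with f x in fx≡
  ... | just _  with i
  ...   | zero  = fx≡
  ...   | suc i = f-source xs i
  f-source (x ∷ xs) i | nothing = f-source xs i

  source-injective : ∀ xs {i j} → source xs i ≡ source xs j → i ≡ j
  source-injective (x ∷ xs) {i} {j} eq with f x
  source-injective (x ∷ xs) {zero}  {zero}  eq | just _  = refl
  source-injective (x ∷ xs) {suc i} {suc j} eq | just _  = cong suc (source-injective xs (Fin.suc-injective eq))
  source-injective (x ∷ xs) {i}     {j}     eq | nothing = source-injective xs (Fin.suc-injective eq)

  source-onto : ∀ xs j {y} → f (List.lookup xs j) ≡ just y → ∃[ i ] source xs i ≡ j
  source-onto (x ∷ xs) zero    fx≡ with f x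
  ... | just _ = zero , refl
  source-onto (x ∷ xs) (suc j) fx≡ with f x | source-onto xs j fx≡
  ... | just _  | i , eq = suc i , cong suc eq
  ... | nothing | i , eq = i , cong suc eq

no-cycleSeq-longer-than-order : (D : Digraph) {k : ℕ} → n D ≤ k →
  (a : Vec (Arc D) (suc k)) → ¬ IsCycleSeq D a
no-cycleSeq-longer-than-order D n≤k a (_ , distinct)
  with i , j , i<j , tᵢ≡tⱼ ← Fin.pigeonhole (s≤s n≤k) (λ i → tailOf D (lookup a i)) =
  Fin.<-irrefl (distinct i j tᵢ≡tⱼ) i<j

cycleCount-vanishes : (D : Digraph) {k : ℕ} → n D ≤ k → cycleCount D (suc k) ≡ 0
cycleCount-vanishes D {k} n≤k = cong (λ as → length (deduplicate (≡-dec _≟ᵇ_) (map arcSet as)))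
  (List.filter-none (isCycleSeq? D) {xs = allVecs (suc k)}
    (All.universal (no-cycleSeq-longer-than-order D n≤k) _))

σ≡cycleCount : (D : Digraph) (k : ℕ) → σ D k ≡ + cycleCount D k
σ≡cycleCount D zero = refl
σ≡cycleCount D (suc k) with suc k ℕ.≤? n D
... | yes _   = refl
... | no k≥n = cong +_ (sym (cycleCount-vanishes D (ℕ.≤-pred (ℕ.≰⇒> k≥n))))

infix 4 _≢?_
_≢?_ : ∀ {m} (i j : Fin m) → Dec (i ≢ j)
i ≢? j = ¬? (i ≟ j)

Joins : (D : Digraph) → Arc D → Arc D → Set
Joins D a b = headOf D a ≡ tailOf D b

Path : (D : Digraph) → Arc D → List (Arc D) → Arc D → Set
Path D a []       c = Joins D a c
Path D a (b ∷ bs) c = Joins D a b × Path D b bs c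

IsCycle : (D : Digraph) → List (Arc D) → Set
IsCycle D []       = ⊥
IsCycle D (a ∷ as) = Path D a as a × Unique (map (tailOf D) (a ∷ as))

toSubset : ∀ {m} → List (Fin m) → Subset m
toSubset []       = ∅
toSubset (x ∷ xs) = ⁅ x ⁆ ∪ toSubset xs

∈-toSubset⁺ : ∀ {m} {x : Fin m} {xs} → x ∈ xs → x ∈ₛ toSubset xs
∈-toSubset⁺ (here refl) = Sub.x∈p∪q⁺ (inj₁ (Sub.x∈⁅x⁆ _))
∈-toSubset⁺ (there x∈)  = Sub.x∈p∪q⁺ (inj₂ (∈-toSubset⁺ x∈))

∈-toSubset⁻ : ∀ {m} {x : Fin m} xs → x ∈ₛ toSubset xs → x ∈ xs
∈-toSubset⁻ []       x∈ = contradiction x∈ Sub.∉⊥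
∈-toSubset⁻ (y ∷ xs) x∈ with Sub.x∈p∪q⁻ ⁅ y ⁆ (toSubset xs) x∈
... | inj₁ x∈⁅y⁆ = here (Sub.x∈⁅y⁆⇒x≡y y x∈⁅y⁆)
... | inj₂ x∈xs  = there (∈-toSubset⁻ xs x∈xs)

toSubset-cong : ∀ {m} {xs ys : List (Fin m)} → (∀ {x} → x ∈ xs → x ∈ ys) → (∀ {x} → x ∈ ys → x ∈ xs) →
  toSubset xs ≡ toSubset ys
toSubset-cong {xs = xs} {ys} xs⊆ys ys⊆xs = Sub.⊆-antisym
  (∈-toSubset⁺ ∘ xs⊆ys ∘ ∈-toSubset⁻ xs) (∈-toSubset⁺ ∘ ys⊆xs ∘ ∈-toSubset⁻ ys)

Lift⇒All : ∀ {m} {P : Fin m → Set} xs → Sub.Lift P (toSubset xs) → All P xs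
Lift⇒All xs P[xs] = All.tabulate (P[xs] ∘ ∈-toSubset⁺)

All⇒Lift : ∀ {m} {P : Fin m → Set} xs → All P xs → Sub.Lift P (toSubset xs)
All⇒Lift xs P[xs] = All.lookup P[xs] ∘ ∈-toSubset⁻ xs

arcSet≡toSubset : ∀ {m k} (a : Vec (Fin m) k) → arcSet a ≡ toSubset (toList a)
arcSet≡toSubset []      = refl
arcSet≡toSubset (x ∷ a) = cong (⁅ x ⁆ ∪_) (arcSet≡toSubset a)

IsCycleSet : (D : Digraph) → ℕ → Subset (length (arcs D)) → Set
IsCycleSet D k S = ∃[ l ] length l ≡ suc k × IsCycle D l × S ≡ toSubset l

lookup-∷ʳ-inject₁ : ∀ {k} (a : Vec A k) z i → lookup (a ∷ʳ z) (inject₁ i) ≡ lookup a i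
lookup-∷ʳ-inject₁ (x ∷ a) z zero    = refl
lookup-∷ʳ-inject₁ (x ∷ a) z (suc i) = lookup-∷ʳ-inject₁ a z i

lookup-∷ʳ-last : ∀ {k} (a : Vec A k) z → lookup (a ∷ʳ z) (fromℕ k) ≡ z
lookup-∷ʳ-last []      z = refl
lookup-∷ʳ-last (x ∷ a) z = lookup-∷ʳ-last a z

lookup-next : ∀ {k} (a : Vec A (suc k)) i → lookup a (next i) ≡ lookup (a ∷ʳ lookup a zero) (suc i)
lookup-next {k = k} a i with suc (toℕ i) ℕ.<? suc k
... | yes i<k = begin
  lookup a (fromℕ< i<k)                               ≡⟨ lookup-∷ʳ-inject₁ a _ _ ⟨
  lookup (a ∷ʳ lookup a zero) (inject₁ (fromℕ< i<k)) ≡⟨ cong (lookup (a ∷ʳ lookup a zero)) (Fin.toℕ-injective toℕ-i+1) ⟩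
  lookup (a ∷ʳ lookup a zero) (suc i)                 ∎
  where
  toℕ-i+1 : toℕ (inject₁ (fromℕ< i<k)) ≡ suc (toℕ i)
  toℕ-i+1 = trans (Fin.toℕ-inject₁ _) (Fin.toℕ-fromℕ< i<k)
... | no i≮k = begin
  lookup a zero                            ≡⟨ lookup-∷ʳ-last a _ ⟨
  lookup (a ∷ʳ lookup a zero) (fromℕ _)    ≡⟨ cong (lookup (a ∷ʳ lookup a zero)) (Fin.toℕ-injective toℕ-last) ⟩
  lookup (a ∷ʳ lookup a zero) (suc i)      ∎
  where
  toℕ-last : toℕ (fromℕ (suc k)) ≡ suc (toℕ i)
  toℕ-last = trans (Fin.toℕ-fromℕ _)
    (cong suc (ℕ.≤-antisym (ℕ.≮⇒≥ (i≮k ∘ s≤s)) (ℕ.≤-pred (Fin.toℕ<n i))))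

Path⇒joins : ∀ (D : Digraph) {k} a (bs : Vec (Arc D) k) c → Path D a (toList bs) c →
  ∀ i → Joins D (lookup (a ∷ bs) i) (lookup ((a ∷ bs) ∷ʳ c) (suc i))
Path⇒joins D a []       c a⇒c        zero    = a⇒c
Path⇒joins D a (b ∷ bs) c (a⇒b , _)  zero    = a⇒b
Path⇒joins D a (b ∷ bs) c (_ , path) (suc i) = Path⇒joins D b bs c path i

joins⇒Path : ∀ (D : Digraph) {k} a (bs : Vec (Arc D) k) c →
  (∀ i → Joins D (lookup (a ∷ bs) i) (lookup ((a ∷ bs) ∷ʳ c) (suc i))) → Path D a (toList bs) c
joins⇒Path D a []       c joins = joins zero
joins⇒Path D a (b ∷ bs) c joins = joins zero , joins⇒Path D b bs c (joins ∘ suc)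

lookup-∈-map-toList : ∀ (f : A → B) {k} (a : Vec A k) i → f (lookup a i) ∈ map f (toList a)
lookup-∈-map-toList f (x ∷ a) zero    = here refl
lookup-∈-map-toList f (x ∷ a) (suc i) = there (lookup-∈-map-toList f a i)

∈-map-toList⇒lookup : ∀ (f : A → B) {k} (a : Vec A k) {y} → y ∈ map f (toList a) → ∃[ i ] f (lookup a i) ≡ y
∈-map-toList⇒lookup f (x ∷ a) (here refl) = zero , refl
∈-map-toList⇒lookup f (x ∷ a) (there y∈) with i , eq ← ∈-map-toList⇒lookup f a y∈ = suc i , eq

Unique⇒lookup-injective : ∀ (f : A → B) {k} (a : Vec A k) → Unique (map f (toList a)) →
  ∀ i j → f (lookup a i) ≡ f (lookup a j) → i ≡ j
Unique⇒lookup-injective f (x ∷ a) (x∉ ∷ !a) zero    zero    _  = refl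
Unique⇒lookup-injective f (x ∷ a) (x∉ ∷ !a) zero    (suc j) eq = contradiction eq (All.lookup x∉ (lookup-∈-map-toList f a j))
Unique⇒lookup-injective f (x ∷ a) (x∉ ∷ !a) (suc i) zero    eq = contradiction (sym eq) (All.lookup x∉ (lookup-∈-map-toList f a i))
Unique⇒lookup-injective f (x ∷ a) (x∉ ∷ !a) (suc i) (suc j) eq = cong suc (Unique⇒lookup-injective f a !a i j eq)

lookup-injective⇒Unique : ∀ (f : A → B) {k} (a : Vec A k) →
  (∀ i j → f (lookup a i) ≡ f (lookup a j) → i ≡ j) → Unique (map f (toList a))
lookup-injective⇒Unique f []      _   = []
lookup-injective⇒Unique f (x ∷ a) inj =
  All.tabulate (λ y∈ x≡y → let j , eq = ∈-map-toList⇒lookup f a y∈ in Fin.0≢1+n (inj zero (suc j) (trans x≡y (sym eq))))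
  ∷ lookup-injective⇒Unique f a (λ i j eq → Fin.suc-injective (inj (suc i) (suc j) eq))

IsCycleSeq⇒IsCycle : ∀ D {k} (a : Vec (Arc D) (suc k)) → IsCycleSeq D a → IsCycle D (toList a)
IsCycleSeq⇒IsCycle D (x ∷ as) (joins , distinct) =
  joins⇒Path D x as x (λ i → subst (Joins D _) (lookup-next (x ∷ as) i) (joins i)) ,
  lookup-injective⇒Unique (tailOf D) (x ∷ as) distinct

IsCycle⇒IsCycleSeq : ∀ D {k} (a : Vec (Arc D) (suc k)) → IsCycle D (toList a) → IsCycleSeq D a
IsCycle⇒IsCycleSeq D (x ∷ as) (path , !tails) =
  (λ i → subst (Joins D _) (sym (lookup-next (x ∷ as) i)) (Path⇒joins D x as x path i)) ,
  Unique⇒lookup-injective (tailOf D) (x ∷ as) !tails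

∈-allVecs : ∀ {m} k (a : Vec (Fin m) k) → a ∈ allVecs k
∈-allVecs zero    []      = here refl
∈-allVecs {m} (suc k) (x ∷ a) = ∈.∈-concatMap⁺ (λ y → map (y ∷_) (allVecs k)) {xs = List.allFin m}
  (Any.map (λ { refl → ∈.∈-map⁺ (x ∷_) (∈-allVecs k a) }) (∈.∈-allFin x))

-- cycleSets D k holds the arc sets of the cycles of length k + 1, matching
-- cycleCount D (suc k).
opaque
  cycleSets : (D : Digraph) → ℕ → List (Subset (length (arcs D)))
  cycleSets D k = deduplicate (≡-dec _≟ᵇ_) (map arcSet (filter (isCycleSeq? D) (allVecs (suc k))))

  cycleCount≡length-cycleSets : ∀ D k → cycleCount D (suc k) ≡ length (cycleSets D k)
  cycleCount≡length-cycleSets D k = refl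

  cycleSets-unique : ∀ D k → Unique (cycleSets D k)
  cycleSets-unique D k = Uniqueᵈ.deduplicate-! (≡-dec _≟ᵇ_) _

  ∈-cycleSets⁻ : ∀ D k {S} → S ∈ cycleSets D k → IsCycleSet D k S
  ∈-cycleSets⁻ D k S∈ with a , a∈ , refl ← ∈.∈-map⁻ arcSet (∈.∈-deduplicate⁻ (≡-dec _≟ᵇ_) _ S∈) =
    toList a , Vec.length-toList a ,
    IsCycleSeq⇒IsCycle D a (proj₂ (∈.∈-filter⁻ (isCycleSeq? D) {xs = allVecs (suc k)} a∈)) ,
    arcSet≡toSubset a

  ∈-cycleSets⁺ : ∀ D k {S} → IsCycleSet D k S → S ∈ cycleSets D k
  ∈-cycleSets⁺ D k (l , len , cycle , refl) =
    subst (_∈ cycleSets D k) (trans (arcSet≡toSubset a) (cong toSubset toList-a))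
      (∈.∈-deduplicate⁺ (≡-dec _≟ᵇ_) (∈.∈-map⁺ arcSet
        (∈.∈-filter⁺ (isCycleSeq? D) (∈-allVecs (suc k) a)
          (IsCycle⇒IsCycleSeq D a (subst (IsCycle D) (sym toList-a) cycle)))))
    where
    a : Vec (Arc D) (suc k)
    a = Vec.cast len (Vec.fromList l)
    toList-a : toList a ≡ l
    toList-a = trans (Vec.toList-cast len (Vec.fromList l)) (Vec.toList∘fromList l)

Path-++⁻ : ∀ D a bs b cs c → Path D a (bs ++ b ∷ cs) c → Path D a bs b × Path D b cs c
Path-++⁻ D a []       b cs c path       = path
Path-++⁻ D a (x ∷ bs) b cs c (a⇒x , path) = Product.map₁ (a⇒x ,_) (Path-++⁻ D x bs b cs c path)

Path-++⁺ : ∀ D a bs b cs c → Path D a bs b → Path D b cs c → Path D a (bs ++ b ∷ cs) c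
Path-++⁺ D a []       b cs c a⇒b          path = a⇒b , path
Path-++⁺ D a (x ∷ bs) b cs c (a⇒x , path) path′ = a⇒x , Path-++⁺ D x bs b cs c path path′

record Rotation (D : Digraph) (l : List (Arc D)) (a : Arc D) : Set where
  field
    rest  : List (Arc D)
    cycle : IsCycle D (a ∷ rest)
    perm  : a ∷ rest ↭ l

  length≡ : length (a ∷ rest) ≡ length l
  length≡ = ↭.↭-length perm

  ∈⁻ : ∀ {b} → b ∈ a ∷ rest → b ∈ l
  ∈⁻ = ↭.∈-resp-↭ perm

  ∈⁺ : ∀ {b} → b ∈ l → b ∈ a ∷ rest
  ∈⁺ = ↭.∈-resp-↭ (↭.↭-sym perm)

rotate : ∀ D {l a} → IsCycle D l → a ∈ l → Rotation D l a
rotate D {a = a} cycle a∈l with ∈.∈-∃++ a∈l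
... | [] , zs , refl = record { rest = zs ; cycle = cycle ; perm = ↭.↭-refl }
... | x ∷ ys , zs , refl = record
  { rest  = zs ++ x ∷ ys
  ; cycle = Path-++⁺ D a zs x ys a a⇒x x⇒a , ↭ₛ.Unique-resp-↭ (≡.setoid _) (↭.↭⇒↭ₛ (↭.map⁺ (tailOf D) (↭.↭-sym perm))) !tails
  ; perm  = perm
  }
  where
  x⇒a = proj₁ (Path-++⁻ D x ys a zs x (proj₁ cycle))
  a⇒x = proj₂ (Path-++⁻ D x ys a zs x (proj₁ cycle))
  !tails = proj₂ cycle
  perm : a ∷ zs ++ x ∷ ys ↭ x ∷ ys ++ a ∷ zs
  perm = ↭.++-comm (a ∷ zs) (x ∷ ys)

successor : ∀ D {l} → IsCycle D l → ∀ {a} → a ∈ l → ∃[ b ] b ∈ l × Joins D a b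
successor D cycle {a} a∈l with rotate D cycle a∈l
... | record { rest = []    ; cycle = a⇒a , _       ; perm = perm } = a , ↭.∈-resp-↭ perm (here refl) , a⇒a
... | record { rest = b ∷ _ ; cycle = (a⇒b , _) , _ ; perm = perm } = b , ↭.∈-resp-↭ perm (there (here refl)) , a⇒b

cyclesWithin : (D : Digraph) {P : Arc D → Set} → Decidable P → ℕ → List (Subset (length (arcs D)))
cyclesWithin D P? k = filter (Sub.Lift? P?) (cycleSets D k)

cyclesLeaving : (D : Digraph) {P : Arc D → Set} → Decidable P → ℕ → List (Subset (length (arcs D)))
cyclesLeaving D P? k = filter (∁? (Sub.Lift? P?)) (cycleSets D k)

cycleCount-split : (D : Digraph) {P : Arc D → Set} (P? : Decidable P) (k : ℕ) →
  cycleCount D (suc k) ≡ length (cyclesWithin D P? k) + length (cyclesLeaving D P? k)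
cycleCount-split D P? k = trans (cycleCount≡length-cycleSets D k) (length-filter-∁ (Sub.Lift? P?) (cycleSets D k))

cycleCount≡length-cyclesWithin-all : (D : Digraph) (k : ℕ) →
  cycleCount D (suc k) ≡ length (cyclesWithin D {λ _ → ⊤} (λ _ → yes tt) k)
cycleCount≡length-cyclesWithin-all D k = trans (cycleCount≡length-cycleSets D k)
  (cong length (sym (List.filter-all (Sub.Lift? (λ _ → yes tt)) (All.universal (λ _ {_} _ → tt) (cycleSets D k)))))

Unique-cyclesWithin : (D : Digraph) {P : Arc D → Set} (P? : Decidable P) (k : ℕ) → Unique (cyclesWithin D P? k)
Unique-cyclesWithin D P? k = Unique.filter⁺ _ (cycleSets-unique D k)

Unique-cyclesLeaving : (D : Digraph) {P : Arc D → Set} (P? : Decidable P) (k : ℕ) → Unique (cyclesLeaving D P? k)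
Unique-cyclesLeaving D P? k = Unique.filter⁺ _ (cycleSets-unique D k)

record ArcEmbedding (D′ D : Digraph) : Set₁ where
  field
    arc           : Arc D′ → Arc D
    arc-injective : ∀ {a b} → arc a ≡ arc b → a ≡ b
    Inner′        : Arc D′ → Set
    inner′?       : Decidable Inner′
    Inner         : Arc D → Set
    inner?        : Decidable Inner
    arc-inner     : ∀ {a} → Inner′ a → Inner (arc a)
    arc-onto      : ∀ {b} → Inner b → ∃[ a ] Inner′ a × arc a ≡ b
    _≈_           : Vertex D → Vertex D′ → Set
    ≈-functional  : ∀ {x a b} → x ≈ a → x ≈ b → a ≡ b
    ≈-injective   : ∀ {x y a} → x ≈ a → y ≈ a → x ≡ y
    tail-≈        : ∀ {a} → Inner′ a → tailOf D (arc a) ≈ tailOf D′ a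
    head-≈        : ∀ {a} → Inner′ a → headOf D (arc a) ≈ headOf D′ a

module _ {D′ D : Digraph} (E : ArcEmbedding D′ D) where
  open ArcEmbedding E

  private
    Joins⁺ : ∀ {a b} → Inner′ a → Inner′ b → Joins D′ a b → Joins D (arc a) (arc b)
    Joins⁺ ia ib a⇒b = ≈-injective (head-≈ ia) (subst (_ ≈_) (sym a⇒b) (tail-≈ ib))

    Joins⁻ : ∀ {a b} → Inner′ a → Inner′ b → Joins D (arc a) (arc b) → Joins D′ a b
    Joins⁻ ia ib a⇒b = ≈-functional (head-≈ ia) (subst (_≈ _) (sym a⇒b) (tail-≈ ib))

    Path⁺ : ∀ a bs c → Inner′ a → All Inner′ bs → Inner′ c → Path D′ a bs c → Path D (arc a) (map arc bs) (arc c)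
    Path⁺ a []       c ia []         ic a⇒c          = Joins⁺ ia ic a⇒c
    Path⁺ a (b ∷ bs) c ia (ib ∷ ibs) ic (a⇒b , path) = Joins⁺ ia ib a⇒b , Path⁺ b bs c ib ibs ic path

    Path⁻ : ∀ a bs c → Inner′ a → All Inner′ bs → Inner′ c → Path D (arc a) (map arc bs) (arc c) → Path D′ a bs c
    Path⁻ a []       c ia []         ic a⇒c          = Joins⁻ ia ic a⇒c
    Path⁻ a (b ∷ bs) c ia (ib ∷ ibs) ic (a⇒b , path) = Joins⁻ ia ib a⇒b , Path⁻ b bs c ib ibs ic path

    IsCycle⁺ : ∀ l → All Inner′ l → IsCycle D′ l → IsCycle D (map arc l)
    IsCycle⁺ (a ∷ as) I[l]@(ia ∷ ias) (path , !tails) =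
      Path⁺ a as a ia ias ia path ,
      subst Unique (List.map-∘ (a ∷ as)) (Unique-map-transfer (tailOf D′) (tailOf D ∘ arc) (a ∷ as) !tails
        (λ x∈ y∈ tx≡ty → ≈-functional (tail-≈ (All.lookup I[l] x∈)) (subst (_≈ _) (sym tx≡ty) (tail-≈ (All.lookup I[l] y∈)))))

    IsCycle⁻ : ∀ l → All Inner′ l → IsCycle D (map arc l) → IsCycle D′ l
    IsCycle⁻ (a ∷ as) I[l]@(ia ∷ ias) (path , !tails) =
      Path⁻ a as a ia ias ia path ,
      Unique-map-transfer (tailOf D ∘ arc) (tailOf D′) (a ∷ as) (subst Unique (sym (List.map-∘ (a ∷ as))) !tails)
        (λ x∈ y∈ tx≡ty → ≈-injective (tail-≈ (All.lookup I[l] x∈)) (subst (_ ≈_) (sym tx≡ty) (tail-≈ (All.lookup I[l] y∈))))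

    Image : Subset (length (arcs D′)) → Subset (length (arcs D)) → Set
    Image S T = (∀ {a} → a ∈ₛ S → arc a ∈ₛ T) × (∀ {b} → b ∈ₛ T → ∃[ a ] a ∈ₛ S × arc a ≡ b)

    Image-toSubset : ∀ l → Image (toSubset l) (toSubset (map arc l))
    Image-toSubset l =
      ∈-toSubset⁺ ∘ ∈.∈-map⁺ arc ∘ ∈-toSubset⁻ l ,
      λ b∈ → let a , a∈ , b≡ = ∈.∈-map⁻ arc (∈-toSubset⁻ (map arc l) b∈) in a , ∈-toSubset⁺ a∈ , sym b≡

    correspondence : ∀ k → Correspondence Image (cyclesWithin D′ inner′? k) (cyclesWithin D inner? k)
    correspondence k = record
      { forth      = forth
      ; back       = back
      ; injective  = λ (S⊆ , ⊆S) (S′⊆ , ⊆S′) → Sub.⊆-antisym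
          (λ a∈S → let a′ , a′∈ , eq = ⊆S′ (S⊆ a∈S) in subst (_∈ₛ _) (arc-injective eq) a′∈)
          (λ a∈S′ → let a′ , a′∈ , eq = ⊆S (S′⊆ a∈S′) in subst (_∈ₛ _) (arc-injective eq) a′∈)
      ; functional = λ (S⊆ , ⊆T) (S⊆′ , ⊆T′) → Sub.⊆-antisym
          (λ b∈T → let a , a∈ , eq = ⊆T b∈T in subst (_∈ₛ _) eq (S⊆′ a∈))
          (λ b∈T′ → let a , a∈ , eq = ⊆T′ b∈T′ in subst (_∈ₛ _) eq (S⊆ a∈))
      }
      where
      forth : ∀ {S} → S ∈ cyclesWithin D′ inner′? k → ∃[ T ] T ∈ cyclesWithin D inner? k × Image S T
      forth S∈ with S∈cycles , I[S] ← ∈.∈-filter⁻ (Sub.Lift? inner′?) S∈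
               with l , len , cycle , refl ← ∈-cycleSets⁻ D′ k S∈cycles =
        toSubset (map arc l) ,
        ∈.∈-filter⁺ (Sub.Lift? inner?)
          (∈-cycleSets⁺ D k (map arc l , trans (List.length-map arc l) len , IsCycle⁺ l I[l] cycle , refl))
          (All⇒Lift (map arc l) (All.map⁺ (All.map arc-inner I[l]))) ,
        Image-toSubset l
        where I[l] = Lift⇒All l I[S]
      back : ∀ {T} → T ∈ cyclesWithin D inner? k → ∃[ S ] S ∈ cyclesWithin D′ inner′? k × Image S T
      back T∈ with T∈cycles , I[T] ← ∈.∈-filter⁻ (Sub.Lift? inner?) T∈
              with l , len , cycle , refl ← ∈-cycleSets⁻ D k T∈cycles
              with l′ , refl , I[l′] ← preimage arc arc-onto l (Lift⇒All l I[T]) =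
        toSubset l′ ,
        ∈.∈-filter⁺ (Sub.Lift? inner′?)
          (∈-cycleSets⁺ D′ k (l′ , trans (sym (List.length-map arc l′)) len , IsCycle⁻ l′ I[l′] cycle , refl))
          (All⇒Lift l′ I[l′]) ,
        Image-toSubset l′

  length-cyclesWithin : ∀ k → length (cyclesWithin D′ inner′? k) ≡ length (cyclesWithin D inner? k)
  length-cyclesWithin k =
    length-≡-correspondence (Unique-cyclesWithin D′ inner′? k) (Unique-cyclesWithin D inner? k) (correspondence k)

deletionEmbedding : (D : Digraph) (e : Arc D) → ArcEmbedding (D − e) D
deletionEmbedding D e = record
  { arc           = skip (arcs D) e
  ; arc-injective = skip-injective (arcs D) e
  ; Inner′        = λ _ → ⊤
  ; inner′?       = λ _ → yes tt
  ; Inner         = _≢ e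
  ; inner?        = _≢? e
  ; arc-inner     = λ {a} _ → skip-≢ (arcs D) e a
  ; arc-onto      = λ {j} j≢e → Product.map₂ (tt ,_) (skip-onto (arcs D) e j j≢e)
  ; _≈_           = _≡_
  ; ≈-functional  = λ x≡a x≡b → trans (sym x≡a) x≡b
  ; ≈-injective   = λ x≡a y≡a → trans x≡a (sym y≡a)
  ; tail-≈        = λ {a} _ → cong proj₁ (sym (lookup-removeAt (arcs D) e a))
  ; head-≈        = λ {a} _ → cong proj₂ (sym (lookup-removeAt (arcs D) e a))
  }

cyclesThrough : (D : Digraph) → Arc D → ℕ → List (Subset (length (arcs D)))
cyclesThrough D e = cyclesLeaving D (_≢? e)

cycleCount-deletion : (D : Digraph) (e : Arc D) (k : ℕ) →
  cycleCount D (suc k) ≡ cycleCount (D − e) (suc k) + length (cyclesThrough D e k)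
cycleCount-deletion D e k = begin
  cycleCount D (suc k)                                   ≡⟨ cycleCount-split D (_≢? e) k ⟩
  length (cyclesWithin D (_≢? e) k) + through            ≡⟨ cong (_+ through) (length-cyclesWithin (deletionEmbedding D e) k) ⟨
  length (cyclesWithin (D − e) (λ _ → yes tt) k) + through ≡⟨ cong (_+ through) (cycleCount≡length-cyclesWithin-all (D − e) k) ⟨
  cycleCount (D − e) (suc k) + through                   ∎
  where through = length (cyclesThrough D e k)

CycleFrom : (D : Digraph) → Arc D → ℕ → Subset (length (arcs D)) → Set
CycleFrom D e k T = ∃[ rest ] length rest ≡ k × IsCycle D (e ∷ rest) × T ≡ toSubset (e ∷ rest)

∈-cyclesThrough⁻ : ∀ D e k {T} → T ∈ cyclesThrough D e k → CycleFrom D e k T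
∈-cyclesThrough⁻ D e k T∈ with T∈cycles , ¬avoids ← ∈.∈-filter⁻ (∁? (Sub.Lift? (_≢? e))) T∈
                          with l , len , cycle , refl ← ∈-cycleSets⁻ D k T∈cycles
                          with e Sub.∈? toSubset l
... | no e∉l  = contradiction (λ {j} j∈ j≡e → e∉l (subst (_∈ₛ _) j≡e j∈)) ¬avoids
... | yes e∈l = rest , ℕ.suc-injective (trans length≡ len) , cycle′ , toSubset-cong ∈⁺ ∈⁻
  where open Rotation (rotate D cycle (∈-toSubset⁻ l e∈l)) renaming (cycle to cycle′)

∈-cyclesThrough⁺ : ∀ D e k {T} → CycleFrom D e k T → T ∈ cyclesThrough D e k
∈-cyclesThrough⁺ D e k (rest , len , cycle , refl) =
  ∈.∈-filter⁺ (∁? (Sub.Lift? (_≢? e)))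
    (∈-cycleSets⁺ D k (e ∷ rest , cong suc len , cycle , refl))
    (λ avoids → avoids (∈-toSubset⁺ {xs = e ∷ rest} (here refl)) refl)

module _ (D : Digraph) (e : Arc D) where

  length-cyclesThrough-loop-0 : IsLoop D e → length (cyclesThrough D e 0) ≡ 1
  length-cyclesThrough-loop-0 loop = length-≡1 (Unique-cyclesLeaving D _ 0)
    (∈-cyclesThrough⁺ D e 0 ([] , refl , (sym loop , [] ∷ []) , refl)) only-cycle
    where
    only-cycle : ∀ {T} → T ∈ cyclesThrough D e 0 → T ≡ toSubset (e ∷ [])
    only-cycle T∈ with [] , _ , _ , T≡ ← ∈-cyclesThrough⁻ D e 0 T∈ = T≡

  length-cyclesThrough-loop-suc : IsLoop D e → ∀ k → length (cyclesThrough D e (suc k)) ≡ 0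
  length-cyclesThrough-loop-suc loop k = length-≡0 no-cycle
    where
    no-cycle : ∀ {T} → T ∈ cyclesThrough D e (suc k) → ⊥
    no-cycle T∈ with b ∷ _ , _ , ((e⇒b , _) , e∉ ∷ _) , _ ← ∈-cyclesThrough⁻ D e (suc k) T∈ =
      All.lookup e∉ (here refl) (trans loop e⇒b)

  length-cyclesThrough-nonloop-0 : ¬ IsLoop D e → length (cyclesThrough D e 0) ≡ 0
  length-cyclesThrough-nonloop-0 ¬loop = length-≡0 no-cycle
    where
    no-cycle : ∀ {T} → T ∈ cyclesThrough D e 0 → ⊥
    no-cycle T∈ with [] , _ , (e⇒e , _) , _ ← ∈-cyclesThrough⁻ D e 0 T∈ = ¬loop (sym e⇒e)

Arrow : ℕ → Set
Arrow n = Fin n × Fin n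

identify : ∀ {n} {u v : Fin (suc n)} → u ≢ v → Fin (suc n) → Fin n
identify {v = v} u≢v x with v ≟ x
... | yes _   = punchOut (u≢v ∘ sym)
... | no v≢x = punchOut v≢x

Kept : ∀ {n} → Fin n → Fin n → Arrow n → Set
Kept u v (t , h) = t ≢ u × h ≢ v

kept? : ∀ {n} (u v : Fin n) → Decidable (Kept u v)
kept? u v (t , h) = t ≢? u ×-dec h ≢? v

contractArc : ∀ {n} {u v : Fin (suc n)} → u ≢ v → Arrow (suc n) → Maybe (Arrow n)
contractArc {u = u} {v} u≢v (t , h) with kept? u v (t , h)
... | yes _ = just (identify u≢v t , identify u≢v h)
... | no _  = nothing

deleteArc : ∀ {n} → Fin (suc n) → Arrow (suc n) → Maybe (Arrow n)
deleteArc x (t , h) with x ≟ t | x ≟ h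
... | no x≢t | no x≢h = just (punchOut x≢t , punchOut x≢h)
... | _      | _      = nothing

daggerArc : ∀ {n} {u v : Fin (suc (suc n))} → u ≢ v → Arrow (suc (suc n)) → Maybe (Arrow n)
daggerArc {u = u} u≢v a = deleteArc u a >>= deleteArc (punchOut u≢v)

suffix : ℕ → Digraph → Digraph
suffix m D = mkDigraph (n D) (List.drop m (arcs D))

mkDigraph-injective : ∀ {n} {xs ys : List (Arrow n)} → mkDigraph n xs ≡ mkDigraph n ys → xs ≡ ys
mkDigraph-injective refl = refl

suffix-map-∷ : ∀ {n} {F G : A → Arrow n} {xs} m {y ys} → List.drop m xs ≡ y ∷ ys →
  suffix (suc m) (mkDigraph n (map F xs)) ≡ mkDigraph n (map G ys) →
  F y ≡ G y → suffix m (mkDigraph n (map F xs)) ≡ mkDigraph n (map G (y ∷ ys))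
suffix-map-∷ {F = F} {G} {xs} m {y} {ys} xs-from-m rest-≡ Fy≡Gy = cong (mkDigraph _) (begin
  List.drop m (map F xs)            ≡⟨ List.drop-map m xs ⟩
  map F (List.drop m xs)            ≡⟨ cong (map F) xs-from-m ⟩
  F y ∷ map F ys                    ≡⟨ cong₂ _∷_ Fy≡Gy (begin
    map F ys                            ≡⟨ cong (map F) (drop-∷ m xs xs-from-m) ⟨
    map F (List.drop (suc m) xs)        ≡⟨ List.drop-map (suc m) xs ⟨
    List.drop (suc m) (map F xs)        ≡⟨ mkDigraph-injective rest-≡ ⟩
    map G ys                            ∎) ⟩
  G y ∷ map G ys                    ∎)

module _ {n} (as : List (Arrow (suc n))) {u v : Fin (suc n)} (u≢v : u ≢ v) where

  private
    identifyArc : Arrow (suc n) → Arrow n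
    identifyArc (t , h) = identify u≢v t , identify u≢v h

  -- The identification map of `contract` is local to its definition and only
  -- unfolds on concrete arcs; hence the comparison runs along the suffixes of
  -- the list of kept arcs.
  contract-suffix : ∀ m ys → List.drop m (filter (kept? u v) as) ≡ ys →
    suffix m (contract as u v) ≡ mkDigraph n (map identifyArc ys)
  contract-suffix m [] from-m with u ≟ v
  ... | yes u≡v = contradiction u≡v u≢v
  ... | no _    = cong (mkDigraph n) (trans (List.drop-map m _) (cong (map _) from-m))
  contract-suffix m ((t , h) ∷ ys) from-m
    with u ≟ v | contract-suffix (suc m) ys (drop-∷ m _ from-m)
  ... | yes u≡v | _    = contradiction u≡v u≢v
  ... | no _    | rest with suffix-map-∷ m from-m rest
  ...   | cons with v ≟ t | v ≟ h
  ...     | yes _ | yes _ = cons (cong₂ _,_ (Fin.punchOut-cong v refl) (Fin.punchOut-cong v refl))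
  ...     | yes _ | no _  = cons (cong₂ _,_ (Fin.punchOut-cong v refl) (Fin.punchOut-cong v refl))
  ...     | no _  | yes _ = cons (cong₂ _,_ (Fin.punchOut-cong v refl) (Fin.punchOut-cong v refl))
  ...     | no _  | no _  = cons (cong₂ _,_ (Fin.punchOut-cong v refl) (Fin.punchOut-cong v refl))

  map-filter-kept : ∀ xs → map identifyArc (filter (kept? u v) xs) ≡ mapMaybe (contractArc u≢v) xs
  map-filter-kept []       = refl
  map-filter-kept (x ∷ xs) with kept? u v x
  ... | yes k = trans (cong (map identifyArc) (List.filter-accept (kept? u v) k)) (cong (identifyArc x ∷_) (map-filter-kept xs))
  ... | no ¬k = trans (cong (map identifyArc) (List.filter-reject (kept? u v) ¬k)) (map-filter-kept xs)

  contract≡ : contract as u v ≡ mkDigraph n (mapMaybe (contractArc u≢v) as)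
  contract≡ = trans (contract-suffix 0 _ refl) (cong (mkDigraph n) (map-filter-kept as))

delVertex≡ : ∀ {n} (x : Fin (suc n)) as → delVertex x as ≡ mapMaybe (deleteArc x) as
delVertex≡ x [] = refl
delVertex≡ x ((t , h) ∷ as) with x ≟ t | x ≟ h
... | yes _ | _     = delVertex≡ x as
... | no _  | yes _ = delVertex≡ x as
... | no _  | no _  = cong (_ ∷_) (delVertex≡ x as)

dagger≡ : ∀ {n} (as : List (Arrow (suc (suc n)))) {u v} (u≢v : u ≢ v) →
  dagger as u v ≡ mkDigraph n (mapMaybe (daggerArc u≢v) as)
dagger≡ as {u} {v} u≢v with u ≟ v
... | yes u≡v = contradiction u≡v u≢v
... | no u≢v′ = cong (mkDigraph _) (begin
  delVertex (punchOut u≢v′) (delVertex u as)               ≡⟨ cong (λ x → delVertex x (delVertex u as)) (Fin.punchOut-cong u refl) ⟩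
  delVertex (punchOut u≢v) (delVertex u as)                ≡⟨ delVertex≡ (punchOut u≢v) (delVertex u as) ⟩
  mapMaybe (deleteArc (punchOut u≢v)) (delVertex u as)     ≡⟨ cong (mapMaybe _) (delVertex≡ u as) ⟩
  mapMaybe (deleteArc (punchOut u≢v)) (mapMaybe (deleteArc u) as) ≡⟨ mapMaybe-mapMaybe (deleteArc u) _ as ⟩
  mapMaybe (daggerArc u≢v) as                              ∎)

module _ {n} {u v : Fin (suc n)} (u≢v : u ≢ v) where

  identify-u : identify u≢v u ≡ identify u≢v v
  identify-u with v ≟ u | v ≟ v
  ... | yes _ | yes _ = refl
  ... | no _  | yes _ = Fin.punchOut-cong v refl
  ... | _     | no v≢v = contradiction refl v≢v

  identify-≡ : ∀ x y → identify u≢v x ≡ identify u≢v y → x ≡ y ⊎ (x ≡ u ⊎ x ≡ v) × (y ≡ u ⊎ y ≡ v)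
  identify-≡ x y eq with v ≟ x | v ≟ y
  ... | yes v≡x | yes v≡y = inj₁ (trans (sym v≡x) v≡y)
  ... | yes v≡x | no v≢y  = inj₂ (inj₂ (sym v≡x) , inj₁ (sym (Fin.punchOut-injective (u≢v ∘ sym) v≢y eq)))
  ... | no v≢x  | yes v≡y = inj₂ (inj₁ (Fin.punchOut-injective v≢x (u≢v ∘ sym) eq) , inj₂ (sym v≡y))
  ... | no v≢x  | no v≢y  = inj₁ (Fin.punchOut-injective v≢x v≢y eq)

  identify-≡-v : ∀ x → identify u≢v x ≡ identify u≢v v → x ≡ u ⊎ x ≡ v
  identify-≡-v x eq with identify-≡ x v eq
  ... | inj₁ x≡v       = inj₂ x≡v
  ... | inj₂ (x∈uv , _) = x∈uv

  identify-injective-≢u : ∀ {x y} → x ≢ u → y ≢ u → identify u≢v x ≡ identify u≢v y → x ≡ y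
  identify-injective-≢u {x} {y} x≢u y≢u eq with identify-≡ x y eq
  ... | inj₁ x≡y                   = x≡y
  ... | inj₂ (inj₁ x≡u , _)        = contradiction x≡u x≢u
  ... | inj₂ (_ , inj₁ y≡u)        = contradiction y≡u y≢u
  ... | inj₂ (inj₂ x≡v , inj₂ y≡v) = trans x≡v (sym y≡v)

  identify-injective-≢v : ∀ {x y} → x ≢ v → y ≢ v → identify u≢v x ≡ identify u≢v y → x ≡ y
  identify-injective-≢v {x} {y} x≢v y≢v eq with identify-≡ x y eq
  ... | inj₁ x≡y                   = x≡y
  ... | inj₂ (inj₂ x≡v , _)        = contradiction x≡v x≢v
  ... | inj₂ (_ , inj₂ y≡v)        = contradiction y≡v y≢v
  ... | inj₂ (inj₁ x≡u , inj₁ y≡u) = trans x≡u (sym y≡u)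

Off : ∀ {m} → Fin m → Fin m → Fin m → Set
Off u v x = x ≢ u × x ≢ v

off? : ∀ {m} (u v : Fin m) → Decidable (Off u v)
off? u v x = x ≢? u ×-dec x ≢? v

ArcOff : (D : Digraph) → Vertex D → Vertex D → Arc D → Set
ArcOff D u v a = Off u v (tailOf D a) × Off u v (headOf D a)

arcOff? : (D : Digraph) (u v : Vertex D) → Decidable (ArcOff D u v)
arcOff? D u v a = off? u v (tailOf D a) ×-dec off? u v (headOf D a)

module Contraction {n} (as : List (Arrow (suc n))) (e : Fin (length as))
                   (u≢v : ¬ IsLoop (mkDigraph (suc n) as) e) where

  D : Digraph
  D = mkDigraph (suc n) as

  u v : Vertex D
  u = tailOf D e
  v = headOf D e

  D/e : Digraph
  D/e = mkDigraph n (mapMaybe (contractArc u≢v) as)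

  μ : Vertex D → Vertex D/e
  μ = identify u≢v

  w : Vertex D/e
  w = μ v

  arc : Arc D/e → Arc D
  arc = source (contractArc u≢v) as

  AvoidsW : Arc D/e → Set
  AvoidsW a = tailOf D/e a ≢ w × headOf D/e a ≢ w

  avoidsW? : Decidable AvoidsW
  avoidsW? a = tailOf D/e a ≢? w ×-dec headOf D/e a ≢? w

  private
    contractArc-just : ∀ x {y} → contractArc u≢v x ≡ just y → Kept u v x × y ≡ (μ (proj₁ x) , μ (proj₂ x))
    contractArc-just x eq with kept? u v x
    contractArc-just x refl | yes kept = kept , refl

    contractArc-kept : ∀ x → Kept u v x → contractArc u≢v x ≡ just (μ (proj₁ x) , μ (proj₂ x))
    contractArc-kept x kept with kept? u v x
    ... | yes _    = refl
    ... | no ¬kept = contradiction kept ¬kept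

  arc-kept : ∀ a → Kept u v (List.lookup as (arc a))
  arc-kept a = proj₁ (contractArc-just _ (f-source _ as a))

  tail-arc : ∀ a → tailOf D/e a ≡ μ (tailOf D (arc a))
  tail-arc a = cong proj₁ (proj₂ (contractArc-just _ (f-source _ as a)))

  head-arc : ∀ a → headOf D/e a ≡ μ (headOf D (arc a))
  head-arc a = cong proj₂ (proj₂ (contractArc-just _ (f-source _ as a)))

  arc-onto : ∀ j → Kept u v (List.lookup as j) → ∃[ a ] arc a ≡ j
  arc-onto j kept = source-onto _ as j (contractArc-kept _ kept)

  tail-arc≢u : ∀ a → tailOf D (arc a) ≢ u
  tail-arc≢u a = proj₁ (arc-kept a)

  head-arc≢v : ∀ a → headOf D (arc a) ≢ v
  head-arc≢v a = proj₂ (arc-kept a)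

  contractionEmbedding : ArcEmbedding D/e D
  contractionEmbedding = record
    { arc           = arc
    ; arc-injective = source-injective _ as
    ; Inner′        = AvoidsW
    ; inner′?       = avoidsW?
    ; Inner         = ArcOff D u v
    ; inner?        = arcOff? D u v
    ; arc-inner     = λ {a} avoids → proj₁ (tail-≈ avoids) , proj₁ (head-≈ avoids)
    ; arc-onto      = onto
    ; _≈_           = λ x x′ → Off u v x × μ x ≡ x′
    ; ≈-functional  = λ (_ , μx≡a) (_ , μx≡b) → trans (sym μx≡a) μx≡b
    ; ≈-injective   = λ ((_ , x≢v) , μx≡a) ((_ , y≢v) , μy≡a) → identify-injective-≢v u≢v x≢v y≢v (trans μx≡a (sym μy≡a))
    ; tail-≈        = tail-≈
    ; head-≈        = head-≈
    }
    where
    tail-≈ : ∀ {a} → AvoidsW a → Off u v (tailOf D (arc a)) × μ (tailOf D (arc a)) ≡ tailOf D/e a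
    tail-≈ {a} (t≢w , _) = (tail-arc≢u a , λ t≡v → t≢w (trans (tail-arc a) (cong μ t≡v))) , sym (tail-arc a)
    head-≈ : ∀ {a} → AvoidsW a → Off u v (headOf D (arc a)) × μ (headOf D (arc a)) ≡ headOf D/e a
    head-≈ {a} (_ , h≢w) = ((λ h≡u → h≢w (trans (head-arc a) (trans (cong μ h≡u) (identify-u u≢v)))) , head-arc≢v a) , sym (head-arc a)
    onto : ∀ {j} → ArcOff D u v j → ∃[ a ] AvoidsW a × arc a ≡ j
    onto {j} ((t≢u , t≢v) , (h≢u , h≢v)) with a , refl ← arc-onto j (t≢u , h≢v) =
      a , ((λ t≡w → [ t≢u , t≢v ]′ (identify-≡-v u≢v _ (trans (sym (tail-arc a)) t≡w)))
        ,  (λ h≡w → [ h≢u , h≢v ]′ (identify-≡-v u≢v _ (trans (sym (head-arc a)) h≡w)))) , refl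

deleteArc-just : ∀ {m} (x : Fin (suc m)) t h {y} → deleteArc x (t , h) ≡ just y →
  Σ (x ≢ t) λ x≢t → Σ (x ≢ h) λ x≢h → y ≡ (punchOut x≢t , punchOut x≢h)
deleteArc-just x t h eq with x ≟ t | x ≟ h
deleteArc-just x t h refl | no x≢t | no x≢h = x≢t , x≢h , refl

deleteArc-off : ∀ {m} (x : Fin (suc m)) t h (x≢t : x ≢ t) (x≢h : x ≢ h) →
  deleteArc x (t , h) ≡ just (punchOut x≢t , punchOut x≢h)
deleteArc-off x t h x≢t x≢h with x ≟ t | x ≟ h
... | no _    | no _    = cong just (cong₂ _,_ (Fin.punchOut-cong x refl) (Fin.punchOut-cong x refl))
... | yes x≡t | _       = contradiction x≡t x≢t
... | no _    | yes x≡h = contradiction x≡h x≢h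

module Dagger {n} (as : List (Arrow (suc (suc n)))) (e : Fin (length as))
              (u≢v : ¬ IsLoop (mkDigraph (suc (suc n)) as) e) where

  D : Digraph
  D = mkDigraph (suc (suc n)) as

  u v : Vertex D
  u = tailOf D e
  v = headOf D e

  D†e : Digraph
  D†e = mkDigraph n (mapMaybe (daggerArc u≢v) as)

  -- x ≈ x′: deleting u and then the image of v relabels x as x′
  _≈_ : Vertex D → Vertex D†e → Set
  x ≈ x′ = Σ (u ≢ x) λ u≢x → Σ (punchOut u≢v ≢ punchOut u≢x) λ v′≢x → punchOut v′≢x ≡ x′

  private
    daggerArc-just : ∀ t h {y} → daggerArc u≢v (t , h) ≡ just y → t ≈ proj₁ y × h ≈ proj₂ y
    daggerArc-just t h eq with deleteArc u (t , h) in u-deleted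
    ... | just (t′ , h′)
      with u≢t , u≢h , refl ← deleteArc-just u t h u-deleted
         | v′≢t′ , v′≢h′ , refl ← deleteArc-just (punchOut u≢v) t′ h′ eq =
      (u≢t , v′≢t′ , refl) , (u≢h , v′≢h′ , refl)

    daggerArc-off : ∀ t h → Off u v t → Off u v h → ∃[ y ] daggerArc u≢v (t , h) ≡ just y
    daggerArc-off t h (t≢u , t≢v) (h≢u , h≢v) =
      _ , trans (cong (_>>= deleteArc (punchOut u≢v)) (deleteArc-off u t h u≢t u≢h))
                (deleteArc-off (punchOut u≢v) _ _ (v′≢ u≢t t≢v) (v′≢ u≢h h≢v))
      where
      u≢t = t≢u ∘ sym
      u≢h = h≢u ∘ sym
      v′≢ : ∀ {x} (u≢x : u ≢ x) → x ≢ v → punchOut u≢v ≢ punchOut u≢x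
      v′≢ u≢x x≢v eq = x≢v (sym (Fin.punchOut-injective u≢v u≢x eq))

  ≈-off : ∀ {x x′} → x ≈ x′ → Off u v x
  ≈-off (u≢x , v′≢x′ , _) = u≢x ∘ sym , λ { refl → v′≢x′ (Fin.punchOut-cong u refl) }

  daggerEmbedding : ArcEmbedding D†e D
  daggerEmbedding = record
    { arc           = source (daggerArc u≢v) as
    ; arc-injective = source-injective _ as
    ; Inner′        = λ _ → ⊤
    ; inner′?       = λ _ → yes tt
    ; Inner         = ArcOff D u v
    ; inner?        = arcOff? D u v
    ; arc-inner     = λ {a} _ → ≈-off (proj₁ (arc-≈ a)) , ≈-off (proj₂ (arc-≈ a))
    ; arc-onto      = λ {j} (t-off , h-off) →
        let _ , defined = daggerArc-off _ _ t-off h-off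
            a , arc≡j   = source-onto _ as j defined
        in a , tt , arc≡j
    ; _≈_           = _≈_
    ; ≈-functional  = λ (_ , _ , x≡a) (_ , _ , x≡b) →
        trans (sym x≡a) (trans (Fin.punchOut-cong (punchOut u≢v) (Fin.punchOut-cong u refl)) x≡b)
    ; ≈-injective   = λ (u≢x , v′≢x′ , x≡a) (u≢y , v′≢y′ , y≡a) →
        Fin.punchOut-injective u≢x u≢y (Fin.punchOut-injective v′≢x′ v′≢y′ (trans x≡a (sym y≡a)))
    ; tail-≈        = λ {a} _ → proj₁ (arc-≈ a)
    ; head-≈        = λ {a} _ → proj₂ (arc-≈ a)
    }
    where
    arc-≈ : ∀ a → tailOf D (source _ as a) ≈ tailOf D†e a × headOf D (source _ as a) ≈ headOf D†e a
    arc-≈ a = daggerArc-just _ _ (f-source _ as a)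

module ThroughW {n} (as : List (Arrow (suc n))) (e : Fin (length as))
                (u≢v : ¬ IsLoop (mkDigraph (suc n) as) e) where

  open Contraction as e u≢v

  Reinserts : Subset (length (arcs D/e)) → Subset (length as) → Set
  Reinserts S T = e ∈ₛ T × (∀ {a} → a ∈ₛ S → arc a ∈ₛ T) × (∀ {j} → j ∈ₛ T → j ≡ e ⊎ ∃[ a ] a ∈ₛ S × arc a ≡ j)

  Reinserts-injective : ∀ {S S′ T} → Reinserts S T → Reinserts S′ T → S ≡ S′
  Reinserts-injective (_ , S⊆ , ⊆S) (_ , S′⊆ , ⊆S′) = Sub.⊆-antisym (⊆ S⊆ ⊆S′) (⊆ S′⊆ ⊆S)
    where
    ⊆ : ∀ {S S′ T} → (∀ {a} → a ∈ₛ S → arc a ∈ₛ T) → (∀ {j} → j ∈ₛ T → j ≡ e ⊎ ∃[ a ] a ∈ₛ S′ × arc a ≡ j) →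
      ∀ {a} → a ∈ₛ S → a ∈ₛ S′
    ⊆ S⊆ ⊆S′ {a} a∈S with ⊆S′ (S⊆ a∈S)
    ... | inj₁ arc≡e            = contradiction (cong (tailOf D) arc≡e) (tail-arc≢u a)
    ... | inj₂ (a′ , a′∈ , eq) = subst (_∈ₛ _) (source-injective _ as eq) a′∈

  Reinserts-functional : ∀ {S T T′} → Reinserts S T → Reinserts S T′ → T ≡ T′
  Reinserts-functional (e∈T , S⊆T , ⊆T) (e∈T′ , S⊆T′ , ⊆T′) = Sub.⊆-antisym (⊆ ⊆T S⊆T′ e∈T′) (⊆ ⊆T′ S⊆T e∈T)
    where
    ⊆ : ∀ {S T T′} → (∀ {j} → j ∈ₛ T → j ≡ e ⊎ ∃[ a ] a ∈ₛ S × arc a ≡ j) → (∀ {a} → a ∈ₛ S → arc a ∈ₛ T′) →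
      e ∈ₛ T′ → ∀ {j} → j ∈ₛ T → j ∈ₛ T′
    ⊆ ⊆T S⊆T′ e∈T′ j∈T with ⊆T j∈T
    ... | inj₁ refl              = e∈T′
    ... | inj₂ (a , a∈S , refl) = S⊆T′ a∈S

  Reinserts-toSubset : ∀ l → Reinserts (toSubset l) (toSubset (e ∷ map arc l))
  Reinserts-toSubset l =
    ∈-toSubset⁺ {xs = e ∷ map arc l} (here refl) ,
    (λ a∈ → ∈-toSubset⁺ (there (∈.∈-map⁺ arc (∈-toSubset⁻ l a∈)))) ,
    λ j∈ → reinserted (∈-toSubset⁻ (e ∷ map arc l) j∈)
    where
    reinserted : ∀ {j} → j ∈ e ∷ map arc l → j ≡ e ⊎ ∃[ a ] a ∈ₛ toSubset l × arc a ≡ j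
    reinserted (here j≡e) = inj₁ j≡e
    reinserted (there j∈) = let a , a∈ , j≡ = ∈.∈-map⁻ arc j∈ in inj₂ (a , ∈-toSubset⁺ a∈ , sym j≡)

  lift-path : ∀ x ys z → Path D/e x ys z → tailOf D/e z ≡ w → All (λ y → tailOf D/e y ≢ w) ys →
    Path D (arc x) (map arc ys) e
  lift-path x [] z x⇒z z-leaves-w [] with identify-≡-v u≢v _ (trans (sym (head-arc x)) (trans x⇒z z-leaves-w))
  ... | inj₁ hx≡u = hx≡u
  ... | inj₂ hx≡v = contradiction hx≡v (head-arc≢v x)
  lift-path x (y ∷ ys) z (x⇒y , path) z-leaves-w (y≢w ∷ ys≢w) =
    identify-injective-≢v u≢v (head-arc≢v x) (λ ty≡v → y≢w (trans (tail-arc y) (cong μ ty≡v)))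
      (trans (sym (head-arc x)) (trans x⇒y (tail-arc y))) ,
    lift-path y ys z path z-leaves-w ys≢w

  lift-cycle : ∀ b rest → IsCycle D/e (b ∷ rest) → tailOf D/e b ≡ w → IsCycle D (e ∷ map arc (b ∷ rest))
  lift-cycle b rest (path , b∉ ∷ !tails) b-leaves-w =
    (e⇒b , lift-path b rest b path b-leaves-w (All.tabulate (λ y∈ ty≡w → All.lookup b∉ (∈.∈-map⁺ _ y∈) (trans b-leaves-w (sym ty≡w))))) ,
    All.tabulate (λ t∈ u≡t → let c , c∈ , t≡ = ∈.∈-map⁻ (tailOf D) t∈
                                 a , _ , c≡ = ∈.∈-map⁻ arc c∈
                              in tail-arc≢u a (sym (trans u≡t (trans t≡ (cong (tailOf D) c≡))))) ∷
    subst Unique (List.map-∘ (b ∷ rest))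
      (Unique-map-transfer (tailOf D/e) (tailOf D ∘ arc) (b ∷ rest) (b∉ ∷ !tails)
        (λ {a} {c} _ _ ta≡tc → trans (tail-arc a) (trans (cong μ ta≡tc) (sym (tail-arc c)))))
    where
    e⇒b : v ≡ tailOf D (arc b)
    e⇒b with identify-≡-v u≢v _ (trans (sym (tail-arc b)) b-leaves-w)
    ... | inj₁ tb≡u = contradiction tb≡u (tail-arc≢u b)
    ... | inj₂ tb≡v = sym tb≡v

  kept-path : ∀ x ys → Path D x ys e → tailOf D x ≢ u →
    All (λ y → tailOf D y ≢ u) ys → All (λ y → tailOf D y ≢ v) ys → All (λ j → Kept u v (List.lookup as j)) (x ∷ ys)
  kept-path x []       x⇒e           tx≢u _              _              = (tx≢u , λ hx≡v → u≢v (trans (sym x⇒e) hx≡v)) ∷ []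
  kept-path x (y ∷ ys) (x⇒y , path) tx≢u (ty≢u ∷ tys≢u) (ty≢v ∷ tys≢v) =
    (tx≢u , λ hx≡v → ty≢v (trans (sym x⇒y) hx≡v)) ∷ kept-path y ys path ty≢u tys≢u tys≢v

  lower-path : ∀ x ys z → Path D (arc x) (map arc ys) e → tailOf D/e z ≡ w → Path D/e x ys z
  lower-path x []       z x⇒e          z-leaves-w = trans (head-arc x) (trans (cong μ x⇒e) (trans (identify-u u≢v) (sym z-leaves-w)))
  lower-path x (y ∷ ys) z (x⇒y , path) z-leaves-w =
    trans (head-arc x) (trans (cong μ x⇒y) (sym (tail-arc y))) , lower-path y ys z path z-leaves-w

  kept-cycle : ∀ y rest → IsCycle D (e ∷ y ∷ rest) → All (λ j → Kept u v (List.lookup as j)) (y ∷ rest)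
  kept-cycle y rest ((e⇒y , path) , u∉ ∷ v∉ ∷ _) =
    kept-path y rest path (λ ty≡u → All.lookup u∉ (here refl) (sym ty≡u))
      (All.tabulate (λ z∈ tz≡u → All.lookup u∉ (there (∈.∈-map⁺ (tailOf D) z∈)) (sym tz≡u)))
      (All.tabulate (λ z∈ tz≡v → All.lookup v∉ (∈.∈-map⁺ (tailOf D) z∈) (trans (sym e⇒y) (sym tz≡v))))

  lower-cycle : ∀ y rest → IsCycle D (e ∷ y ∷ rest) →
    ∃[ b ] ∃[ rest′ ] map arc (b ∷ rest′) ≡ y ∷ rest × IsCycle D/e (b ∷ rest′) × tailOf D/e b ≡ w
  lower-cycle y rest cycle@((e⇒y , path) , _ ∷ v∉ ∷ !tails)
    with b ∷ rest′ , refl , _ ← preimage arc (λ {j} kept → let a , eq = arc-onto j kept in a , tt , eq) (y ∷ rest)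
                                  (kept-cycle y rest cycle) =
    b , rest′ , refl , cycle′ , b-leaves-w
    where
    b-leaves-w : tailOf D/e b ≡ w
    b-leaves-w = trans (tail-arc b) (cong μ (sym e⇒y))
    cycle′ : IsCycle D/e (b ∷ rest′)
    cycle′ = lower-path b rest′ b path b-leaves-w ,
      Unique-map-transfer (tailOf D ∘ arc) (tailOf D/e) (b ∷ rest′) (subst Unique (sym (List.map-∘ (b ∷ rest′))) (v∉ ∷ !tails))
        (λ {a} {c} _ _ ta≡tc → identify-injective-≢u u≢v (tail-arc≢u a) (tail-arc≢u c)
           (trans (sym (tail-arc a)) (trans ta≡tc (tail-arc c))))

  arc-leaving-w : ∀ {l} → IsCycle D/e l → ¬ Sub.Lift AvoidsW (toSubset l) → ∃[ b ] b ∈ l × tailOf D/e b ≡ w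
  arc-leaving-w {l} cycle ¬avoids
    with a , a∈l , ¬avoids-a ← find (All.¬All⇒Any¬ avoidsW? l (¬avoids ∘ All⇒Lift l))
    with tailOf D/e a ≟ w | headOf D/e a ≟ w
  ... | yes ta≡w | _        = a , a∈l , ta≡w
  ... | no ta≢w  | yes ha≡w = let b , b∈l , a⇒b = successor D/e cycle a∈l in b , b∈l , trans (sym a⇒b) ha≡w
  ... | no ta≢w  | no ha≢w  = contradiction (ta≢w , ha≢w) ¬avoids-a

  correspondence : ∀ k → Correspondence Reinserts (cyclesLeaving D/e avoidsW? k) (cyclesThrough D e (suc k))
  correspondence k = record
    { forth      = forth
    ; back       = back
    ; injective  = Reinserts-injective
    ; functional = Reinserts-functional
    }
    where
    forth : ∀ {S} → S ∈ cyclesLeaving D/e avoidsW? k → ∃[ T ] T ∈ cyclesThrough D e (suc k) × Reinserts S T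
    forth S∈ with S∈cycles , ¬avoids ← ∈.∈-filter⁻ (∁? (Sub.Lift? avoidsW?)) S∈
             with l , len , cycle , refl ← ∈-cycleSets⁻ D/e k S∈cycles
             with b , b∈l , b-leaves-w ← arc-leaving-w cycle ¬avoids =
      toSubset (e ∷ map arc (b ∷ rest)) ,
      ∈-cyclesThrough⁺ D e (suc k)
        (map arc (b ∷ rest) , trans (List.length-map arc (b ∷ rest)) (trans length≡ len) , lift-cycle b rest cycle′ b-leaves-w , refl) ,
      subst (λ S → Reinserts S (toSubset (e ∷ map arc (b ∷ rest)))) (toSubset-cong ∈⁻ ∈⁺) (Reinserts-toSubset (b ∷ rest))
      where open Rotation (rotate D/e cycle b∈l) renaming (cycle to cycle′)
    back : ∀ {T} → T ∈ cyclesThrough D e (suc k) → ∃[ S ] S ∈ cyclesLeaving D/e avoidsW? k × Reinserts S T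
    back T∈ with y ∷ rest , len , cycle , refl ← ∈-cyclesThrough⁻ D e (suc k) T∈
            with b , rest′ , refl , cycle′ , b-leaves-w ← lower-cycle y rest cycle =
      toSubset (b ∷ rest′) ,
      ∈.∈-filter⁺ (∁? (Sub.Lift? avoidsW?))
        (∈-cycleSets⁺ D/e k (b ∷ rest′ , trans (sym (List.length-map arc (b ∷ rest′))) len , cycle′ , refl))
        (λ avoids → proj₁ (avoids (∈-toSubset⁺ {xs = b ∷ rest′} (here refl))) b-leaves-w) ,
      Reinserts-toSubset (b ∷ rest′)

  length-cyclesThrough-suc : ∀ k → length (cyclesLeaving D/e avoidsW? k) ≡ length (cyclesThrough D e (suc k))
  length-cyclesThrough-suc k =
    length-≡-correspondence (Unique-cyclesLeaving D/e avoidsW? k) (Unique-cyclesLeaving D _ (suc k)) (correspondence k)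

pos-+-telescope : ∀ m n o → + (m + n) ≡ (+ m ℤ.+ + (o + n)) ℤ.- + o
pos-+-telescope m n o = begin
  + (m + n)                       ≡⟨ ℤ.pos-+ m n ⟩
  + m ℤ.+ + n                     ≡⟨ telescope (+ m) (+ n) (+ o) ⟩
  (+ m ℤ.+ (+ o ℤ.+ + n)) ℤ.- + o ≡⟨ cong (λ x → (+ m ℤ.+ x) ℤ.- + o) (ℤ.pos-+ o n) ⟨
  (+ m ℤ.+ + (o + n)) ℤ.- + o     ∎
  where
  telescope : ∀ a b c → a ℤ.+ b ≡ (a ℤ.+ (c ℤ.+ b)) ℤ.- c
  telescope = solve-∀

loop-recurrence : (D : Digraph) (e : Arc D) → IsLoop D e → σ D ≗ σ (D − e) +ₚ X
loop-recurrence D e loop zero    = refl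
loop-recurrence D e loop (suc k) = begin
  σ D (suc k)                                     ≡⟨ σ≡cycleCount D (suc k) ⟩
  + cycleCount D (suc k)                          ≡⟨ cong +_ (cycleCount-deletion D e k) ⟩
  + (cycleCount (D − e) (suc k) + through k)      ≡⟨ ℤ.pos-+ (cycleCount (D − e) (suc k)) (through k) ⟩
  + cycleCount (D − e) (suc k) ℤ.+ + through k    ≡⟨ cong₂ ℤ._+_ (σ≡cycleCount (D − e) (suc k)) (X-suc k) ⟨
  σ (D − e) (suc k) ℤ.+ X (suc k)                 ∎
  where
  through = λ k → length (cyclesThrough D e k)
  X-suc : ∀ k → X (suc k) ≡ + through k
  X-suc zero    = cong +_ (sym (length-cyclesThrough-loop-0 D e loop))
  X-suc (suc k) = cong +_ (sym (length-cyclesThrough-loop-suc D e loop k))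

module _ {n} (as : List (Arrow (suc (suc n)))) (e : Fin (length as))
         (u≢v : ¬ IsLoop (mkDigraph (suc (suc n)) as) e) where

  open Contraction as e u≢v
  open Dagger as e u≢v using (D†e; daggerEmbedding)

  cycleCount-contraction : ∀ k →
    cycleCount D/e k ≡ cycleCount D†e k + length (cyclesThrough D e k)
  cycleCount-contraction zero    = sym (length-cyclesThrough-nonloop-0 D e u≢v)
  cycleCount-contraction (suc k) = begin
    cycleCount D/e (suc k)                                                        ≡⟨ cycleCount-split D/e avoidsW? k ⟩
    length (cyclesWithin D/e avoidsW? k) + length (cyclesLeaving D/e avoidsW? k) ≡⟨ cong₂ _+_ within leaving ⟩
    cycleCount D†e (suc k) + length (cyclesThrough D e (suc k))                 ∎
    where
    within : length (cyclesWithin D/e avoidsW? k) ≡ cycleCount D†e (suc k)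
    within = begin
      length (cyclesWithin D/e avoidsW? k)       ≡⟨ length-cyclesWithin contractionEmbedding k ⟩
      length (cyclesWithin D (arcOff? D u v) k)  ≡⟨ length-cyclesWithin daggerEmbedding k ⟨
      length (cyclesWithin D†e (λ _ → yes tt) k) ≡⟨ cycleCount≡length-cyclesWithin-all D†e k ⟨
      cycleCount D†e (suc k)                     ∎
    leaving = ThroughW.length-cyclesThrough-suc as e u≢v k

  nonloop-recurrence-normalised : σ D ≗ σ (D − e) +ₚ x* σ D/e -ₚ x* σ D†e
  nonloop-recurrence-normalised zero    = refl
  nonloop-recurrence-normalised (suc k) = begin
    σ D (suc k)                           ≡⟨ σ≡cycleCount D (suc k) ⟩
    + cycleCount D (suc k)                ≡⟨ cong +_ (cycleCount-deletion D e k) ⟩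
    + (c₋ + through)                      ≡⟨ pos-+-telescope c₋ through c† ⟩
    (+ c₋ ℤ.+ + (c† + through)) ℤ.- + c†  ≡⟨ cong (λ c → (+ c₋ ℤ.+ + c) ℤ.- + c†) (cycleCount-contraction k) ⟨
    (+ c₋ ℤ.+ + c/) ℤ.- + c†              ≡⟨ cong₂ (λ a b → (a ℤ.+ b) ℤ.- + c†) (σ≡cycleCount (D − e) (suc k)) (σ≡cycleCount D/e k) ⟨
    (σ (D − e) (suc k) ℤ.+ σ D/e k) ℤ.- + c†  ≡⟨ cong (λ c → (σ (D − e) (suc k) ℤ.+ σ D/e k) ℤ.- c) (σ≡cycleCount D†e k) ⟨
    (σ (D − e) (suc k) ℤ.+ σ D/e k) ℤ.- σ D†e k ∎
    where
    c₋ = cycleCount (D − e) (suc k)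
    c/ = cycleCount D/e k
    c† = cycleCount D†e k
    through = length (cyclesThrough D e k)

nonloop-recurrence : (D : Digraph) (e : Arc D) → ¬ IsLoop D e →
  σ D ≗ σ (D − e) +ₚ x* σ (D / e) -ₚ x* σ (D † e)
nonloop-recurrence (mkDigraph zero          as) e _     = contradiction (tailOf (mkDigraph 0 as) e) Fin.¬Fin0
nonloop-recurrence (mkDigraph (suc zero)    as) e ¬loop = contradiction (Fin1-≡ _ _) ¬loop
  where
  Fin1-≡ : (i j : Fin 1) → i ≡ j
  Fin1-≡ zero zero = refl
nonloop-recurrence (mkDigraph (suc (suc n)) as) e ¬loop
  rewrite contract≡ as ¬loop | dagger≡ as ¬loop = nonloop-recurrence-normalised as e ¬loop

theorem2p1 : (D : Digraph) (e : Arc D) →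
    (IsLoop D e → σ D ≗ σ (D − e) +ₚ X)
    × (¬ IsLoop D e → NoLoopAt D (tailOf D e) → NoLoopAt D (headOf D e) →
    σ D ≗ σ (D − e) +ₚ x* σ (D / e) -ₚ x* σ (D † e))
theorem2p1 D e = loop-recurrence D e , λ ¬loop _ _ → nonloop-recurrence D e ¬loop
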